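{- Let $p$ be a prime, $n\ge1$, $F=\mathbb{F}_{p^n}$, and let $f(x)=x^d$ be a monomial function on $F$ with $d^\circ(f)\le p$. Define $\mu_a(x)=a^dx$ for $a\in F^\times$, and $\nu(a)=a^{ -1}$ for $a\ne0$, $\nu(0)=0$. Then $\tilde B_{f,\mu,\nu}(x,a)$ is $\mathbb{F}_p$-bilinear in $(x,a)$.
   Context: For $m\ge1$, $[f]^m(x_1,\dots,x_m)=\sum_{I\subseteq\{1,\dots,m\}}(-1)^{m-|I|}f\big(\sum_{k\in I}x_k\big)$, $[f]^0=f(0)$; for nonzero $f$, $d^\circ(f)$ is the largest $m\ge0$ with $[f]^m\not\equiv0$. $\tilde B_f(x,y)=[f]^p(x,y,\dots,y)$ ($y$ repeated $p-1$ times). For a map $a\mapsto\mu_a$ from $F^\times$ to $\mathbb{F}_p$-linear automorphisms of $F$ and a permutation $\nu$ of $F$ fixing $0$, $\tilde B_{f,\mu,\nu}(x,a)=\mu_a(\tilde B_f(x,\nu(a)))$ for $a\neq0$ and $\tilde B_{f,\mu,\nu}(x,0)=0$. -}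

module Defs where

open import Level using (Level; _⊔_)
open import Algebra.Bundles using (CommutativeRing)
open import Data.Nat as ℕ using (ℕ; zero; suc; _≤_)
open import Data.Fin using (Fin; zero; suc)
open import Data.Bool using (Bool; true; false)
open import Data.Vec using (Vec; []; _∷_)
open import Data.List using (List; []; _∷_; _++_; map; foldr)
open import Data.Product using (Σ; _×_)
open import Relation.Binary.PropositionalEquality using (_≡_)
open import Relation.Nullary using (¬_; yes; no)
open import Relation.Binary.Definitions using (Decidable)

-- A field: a commutative ring with 1 ≠ 0, a multiplicative inverse
-- function (value at 0 irrelevant) and decidable equality.
record Field (c ℓ : Level) : Set (Level.suc (c ⊔ ℓ)) where
  field
    commRing : CommutativeRing c ℓ
  open CommutativeRing commRing public
  field
    1≉0    : ¬ (1# ≈ 0#)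
    _⁻¹    : Carrier → Carrier
    ⁻¹-inv : ∀ x → ¬ (x ≈ 0#) → (x * (x ⁻¹)) ≈ 1#
    _≟_    : Decidable _≈_

-- F is finite with exactly q elements (bijective enumeration up to ≈).
HasCard : ∀ {c ℓ} → Field c ℓ → ℕ → Set (c ⊔ ℓ)
HasCard F q = Σ (Fin q → Carrier) λ e →
    (∀ x → Σ (Fin q) λ i → e i ≈ x) × (∀ i j → e i ≈ e j → i ≡ j)
  where open Field F

module FieldOps {c ℓ} (F : Field c ℓ) where
  open Field F using (Carrier; _≈_; _+_; _*_; -_; 0#; 1#; _⁻¹; _≟_)

  pow : Carrier → ℕ → Carrier
  pow x zero    = 1#
  pow x (suc d) = x * pow x d

  -- natural multiple k · x  (the action of the prime field)
  nmul : ℕ → Carrier → Carrier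
  nmul zero    x = 0#
  nmul (suc k) x = x + nmul k x

  -- all subsets of {1..m}, as characteristic vectors
  subsets : (m : ℕ) → List (Vec Bool m)
  subsets zero    = [] ∷ []
  subsets (suc m) = map (true ∷_) (subsets m) ++ map (false ∷_) (subsets m)

  sumSel : ∀ {m} → Vec Bool m → (Fin m → Carrier) → Carrier
  sumSel []          xs = 0#
  sumSel (true ∷ I)  xs = xs zero + sumSel I (λ i → xs (suc i))
  sumSel (false ∷ I) xs = sumSel I (λ i → xs (suc i))

  sign : ∀ {m} → Vec Bool m → Carrier
  sign []          = 1#
  sign (true ∷ I)  = sign I
  sign (false ∷ I) = (- 1#) * sign I

  -- [f]^m(x_1,…,x_m) = Σ_I (-1)^{m-|I|} f(Σ_{k∈I} x_k)   ([f]^0 = f(0))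
  deriv : (Carrier → Carrier) → (m : ℕ) → (Fin m → Carrier) → Carrier
  deriv f m xs = foldr (λ I acc → (sign I * f (sumSel I xs)) + acc) 0# (subsets m)

  DegLe : (Carrier → Carrier) → ℕ → Set (c ⊔ ℓ)
  DegLe f k = ∀ m → ¬ (∀ xs → deriv f m xs ≈ 0#) → m ≤ k

  xyy : Carrier → Carrier → (m : ℕ) → Fin m → Carrier
  xyy x y m zero    = x
  xyy x y m (suc i) = y

  Btilde : (Carrier → Carrier) → ℕ → Carrier → Carrier → Carrier
  Btilde f p x y = deriv f p (xyy x y p)

  ν : Carrier → Carrier
  ν a with a ≟ 0#
  ... | yes _ = 0#
  ... | no  _ = a ⁻¹

  -- B̃_{f,μ,ν}(x,a) with μ_a(z) = a^d z : a^d · B̃_f(x, ν a) for a ≠ 0, 0 for a = 0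
  BtildeMuNu : ℕ → ℕ → Carrier → Carrier → Carrier
  BtildeMuNu p d x a with a ≟ 0#
  ... | yes _ = 0#
  ... | no  _ = pow a d * Btilde (λ z → pow z d) p x (ν a)

  IsFpLinear : (Carrier → Carrier) → Set (c ⊔ ℓ)
  IsFpLinear g = (∀ x y → g (x + y) ≈ (g x + g y)) × (∀ k x → g (nmul k x) ≈ nmul k (g x))

  IsFpBilinear : (Carrier → Carrier → Carrier) → Set (c ⊔ ℓ)
  IsFpBilinear B = (∀ a → IsFpLinear (λ x → B x a)) × (∀ x → IsFpLinear (λ a → B x a))

module Submission where

-- Proof idea.  Write f(x) = x^d and B(x,y) = [f]^p(x,y,…,y), with p = q + 1.
--
--  * Discrete derivatives peel off their first argument:
--      [f]^{m+1}(x, ys) = [Δ_x f]^m(ys),   where (Δ_x f)(z) = f(x+z) − f(z),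
--    and the cocycle identity Δ_{x₁+x₂} f = Δ_{x₂} Δ_{x₁} f + Δ_{x₁} f + Δ_{x₂} f
--    shows that x ↦ [f]^{m+1}(x, ys) is additive up to the error term
--    [f]^{m+2}(x₁, x₂, ys).  Since d°(f) ≤ p, the derivative [f]^{p+1}
--    vanishes, so x ↦ B(x,y) is additive; additive maps are F_p-linear.
--  * [f]^m is homogeneous: scaling every argument by t scales [f]^m by t^d.
--    Hence for a ≠ 0,  a^d · B(x, a⁻¹) = a^d · (a⁻¹)^d · B(ax, 1) = B(ax, 1),
--    and also for a = 0 the value 0 equals B(0, 1).  So B̃_{f,μ,ν}(x,a) = L(ax)
--    with L = B(·, 1) additive, which is bilinear in (x, a).

open import Defs
open import Data.Nat using (ℕ; _≤_; _^_)
open import Data.Nat.Primality using (Prime)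

open import Data.Nat using (zero; suc; _<_)
open import Data.Nat.Properties using (<⇒≱; n<1+n)
open import Data.Nat.Primality using (¬prime[0])
open import Data.Fin using (zero; suc)
open import Data.Bool using (Bool; true; false)
open import Data.Vec using (Vec; []; _∷_)
open import Data.Vec.Functional as Vector using (Vector)
open import Data.List using (List; []; _∷_; _++_; map; foldr)
open import Data.Product using (_,_)
open import Relation.Nullary using (¬_; yes; no)
open import Relation.Binary.PropositionalEquality as ≡ using (_≡_)
open import Data.Empty using (⊥-elim)
import Algebra.Properties.Ring as RingProperties
import Algebra.Properties.Group as GroupProperties
import Algebra.Properties.CommutativeSemigroup as CommutativeSemigroupProperties
import Relation.Binary.Reasoning.Setoid as SetoidReasoning

module DiscreteDerivatives {c ℓ} (F : Field c ℓ) where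
  open Field F hiding (zero)
  open FieldOps F
  open SetoidReasoning setoid
  open RingProperties ring using (-1*x≈-x; -‿distribˡ-*; -‿distribʳ-*; x+x≈x⇒x≈0)
  open GroupProperties +-group using (//-rightDividesˡ; \\-leftDividesʳ)
  open CommutativeSemigroupProperties +-commutativeSemigroup using (interchange)
  open CommutativeSemigroupProperties *-commutativeSemigroup using () renaming (x∙yz≈y∙xz to *-swapˡ)

  Congruent : (Carrier → Carrier) → Set _
  Congruent g = ∀ {u v} → u ≈ v → g u ≈ g v

  Additive : (Carrier → Carrier) → Set _
  Additive g = ∀ x y → g (x + y) ≈ g x + g y

  sumOver : ∀ {m} → (Vec Bool m → Carrier) → List (Vec Bool m) → Carrier
  sumOver g = foldr (λ I acc → g I + acc) 0#

  sumOver-++ : ∀ {m} (g : Vec Bool m → Carrier) L₁ L₂ →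
               sumOver g (L₁ ++ L₂) ≈ sumOver g L₁ + sumOver g L₂
  sumOver-++ g []       L₂ = sym (+-identityˡ _)
  sumOver-++ g (I ∷ L₁) L₂ = trans (+-congˡ (sumOver-++ g L₁ L₂)) (sym (+-assoc _ _ _))

  sumOver-map : ∀ {m k} (g : Vec Bool m → Carrier) (h : Vec Bool k → Vec Bool m) L →
                sumOver g (map h L) ≡ sumOver (λ I → g (h I)) L
  sumOver-map g h []      = ≡.refl
  sumOver-map g h (I ∷ L) = ≡.cong (g (h I) +_) (sumOver-map g h L)

  sumOver-cong : ∀ {m} {g₁ g₂ : Vec Bool m → Carrier} L → (∀ I → g₁ I ≈ g₂ I) →
                 sumOver g₁ L ≈ sumOver g₂ L
  sumOver-cong []      e = refl
  sumOver-cong (I ∷ L) e = +-cong (e I) (sumOver-cong L e)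

  sumOver-+ : ∀ {m} (g₁ g₂ : Vec Bool m → Carrier) L →
              sumOver (λ I → g₁ I + g₂ I) L ≈ sumOver g₁ L + sumOver g₂ L
  sumOver-+ g₁ g₂ []      = sym (+-identityˡ _)
  sumOver-+ g₁ g₂ (I ∷ L) = trans (+-congˡ (sumOver-+ g₁ g₂ L)) (interchange _ _ _ _)

  sumOver-* : ∀ {m} k (g : Vec Bool m → Carrier) L →
              sumOver (λ I → k * g I) L ≈ k * sumOver g L
  sumOver-* k g []      = sym (zeroʳ k)
  sumOver-* k g (I ∷ L) = trans (+-congˡ (sumOver-* k g L)) (sym (distribˡ k _ _))

  sumSel-cong : ∀ {m} (I : Vec Bool m) {xs ys : Vector Carrier m} →
                (∀ i → xs i ≈ ys i) → sumSel I xs ≈ sumSel I ys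
  sumSel-cong []          e = refl
  sumSel-cong (true ∷ I)  e = +-cong (e zero) (sumSel-cong I (λ i → e (suc i)))
  sumSel-cong (false ∷ I) e = sumSel-cong I (λ i → e (suc i))

  sumSel-scale : ∀ {m} (I : Vec Bool m) t (xs : Vector Carrier m) →
                 sumSel I (λ i → t * xs i) ≈ t * sumSel I xs
  sumSel-scale []          t xs = sym (zeroʳ t)
  sumSel-scale (true ∷ I)  t xs = trans (+-congˡ (sumSel-scale I t _)) (sym (distribˡ t _ _))
  sumSel-scale (false ∷ I) t xs = sumSel-scale I t _

  deriv-*-fun : ∀ k f m xs → deriv (λ z → k * f z) m xs ≈ k * deriv f m xs
  deriv-*-fun k f m xs =
    trans (sumOver-cong (subsets m) (λ I → *-swapˡ _ _ _)) (sumOver-* k _ (subsets m))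

  deriv-cong-fun : ∀ {f g} m xs → (∀ z → f z ≈ g z) → deriv f m xs ≈ deriv g m xs
  deriv-cong-fun m xs e = sumOver-cong (subsets m) (λ I → *-congˡ (e _))

  deriv-+ : ∀ f g m xs → deriv (λ z → f z + g z) m xs ≈ deriv f m xs + deriv g m xs
  deriv-+ f g m xs =
    trans (sumOver-cong (subsets m) (λ I → distribˡ _ _ _)) (sumOver-+ _ _ (subsets m))

  deriv-cong-args : ∀ {f} → Congruent f → ∀ m {xs ys : Vector Carrier m} →
                    (∀ i → xs i ≈ ys i) → deriv f m xs ≈ deriv f m ys
  deriv-cong-args fc m e = sumOver-cong (subsets m) (λ I → *-congˡ (fc (sumSel-cong I e)))

  deriv-scale : ∀ {f} → Congruent f → ∀ m xs t k → (∀ z → f (t * z) ≈ k * f z) →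
                deriv f m (λ i → t * xs i) ≈ k * deriv f m xs
  deriv-scale fc m xs t k hom = trans
    (sumOver-cong (subsets m) (λ I →
       trans (*-congˡ (trans (fc (sumSel-scale I t xs)) (hom _))) (*-swapˡ _ _ _)))
    (sumOver-* k _ (subsets m))

  Δ : Carrier → (Carrier → Carrier) → Carrier → Carrier
  Δ a g z = g (a + z) + - g z

  -- Peeling off the first argument: [f]^{m+1}(x, ys) = [Δ_x f]^m(ys).  The subsets
  -- of {1..m+1} containing 1 give the f(x + …) terms, the others the −f(…) terms.
  deriv-suc : ∀ f m xs → deriv f (suc m) xs ≈ deriv (Δ (Vector.head xs) f) m (Vector.tail xs)
  deriv-suc f m xs = begin
    sumOver G (map (true ∷_) L ++ map (false ∷_) L)
      ≈⟨ sumOver-++ G (map (true ∷_) L) (map (false ∷_) L) ⟩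
    sumOver G (map (true ∷_) L) + sumOver G (map (false ∷_) L)
      ≈⟨ +-cong (reflexive (sumOver-map G _ L)) (reflexive (sumOver-map G _ L)) ⟩
    sumOver (λ I → G (true ∷ I)) L + sumOver (λ I → G (false ∷ I)) L
      ≈⟨ +-congˡ (sumOver-cong L negate) ⟩
    sumOver (λ I → G (true ∷ I)) L + sumOver (λ I → sign I * - f (sumSel I ys)) L
      ≈⟨ sumOver-+ _ _ L ⟨
    sumOver (λ I → sign I * f (Vector.head xs + sumSel I ys) + sign I * - f (sumSel I ys)) L
      ≈⟨ sumOver-cong L (λ I → distribˡ _ _ _) ⟨
    deriv (Δ (Vector.head xs) f) m ys ∎
    where
    L  = subsets m
    ys = Vector.tail xs
    G : Vec Bool (suc m) → Carrier
    G I = sign I * f (sumSel I xs)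
    negate : ∀ I → (- 1# * sign I) * f (sumSel I ys) ≈ sign I * - f (sumSel I ys)
    negate I = trans (*-congʳ (-1*x≈-x _)) (trans (sym (-‿distribˡ-* _ _)) (-‿distribʳ-* _ _))

  Δ-+ : ∀ {f} → Congruent f → ∀ x₁ x₂ z →
        Δ (x₁ + x₂) f z ≈ Δ x₂ (Δ x₁ f) z + (Δ x₁ f z + Δ x₂ f z)
  Δ-+ {f} fc x₁ x₂ z = begin
    f ((x₁ + x₂) + z) + - D           ≈⟨ +-congʳ (fc (+-assoc x₁ x₂ z)) ⟩
    A + - D                           ≈⟨ telescope A B D ⟨
    (A + - B) + (B + - D)             ≈⟨ +-congʳ (//-rightDividesˡ (C + - D) (A + - B)) ⟨
    ((A + - B) + - (C + - D) + (C + - D)) + (B + - D) ≈⟨ +-assoc _ _ _ ⟩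
    Δ x₂ (Δ x₁ f) z + (Δ x₁ f z + Δ x₂ f z) ∎
    where
    A = f (x₁ + (x₂ + z))
    B = f (x₂ + z)
    C = f (x₁ + z)
    D = f z
    telescope : ∀ u v w → (u + - v) + (v + - w) ≈ u + - w
    telescope u v w = trans (+-assoc _ _ _) (+-congˡ (\\-leftDividesʳ v (- w)))

  deriv-first-+ : ∀ {f} → Congruent f → ∀ m x₁ x₂ ys →
    deriv (Δ (x₁ + x₂) f) m ys ≈
    deriv f (suc (suc m)) (x₁ Vector.∷ x₂ Vector.∷ ys) + (deriv (Δ x₁ f) m ys + deriv (Δ x₂ f) m ys)
  deriv-first-+ {f} fc m x₁ x₂ ys = begin
    deriv (Δ (x₁ + x₂) f) m ys
      ≈⟨ deriv-cong-fun m ys (Δ-+ fc x₁ x₂) ⟩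
    deriv (λ z → Δ x₂ (Δ x₁ f) z + (Δ x₁ f z + Δ x₂ f z)) m ys
      ≈⟨ deriv-+ (Δ x₂ (Δ x₁ f)) (λ z → Δ x₁ f z + Δ x₂ f z) m ys ⟩
    deriv (Δ x₂ (Δ x₁ f)) m ys + deriv (λ z → Δ x₁ f z + Δ x₂ f z) m ys
      ≈⟨ +-cong second-derivative (deriv-+ (Δ x₁ f) (Δ x₂ f) m ys) ⟩
    deriv f (suc (suc m)) (x₁ Vector.∷ x₂ Vector.∷ ys) + (deriv (Δ x₁ f) m ys + deriv (Δ x₂ f) m ys) ∎
    where
    second-derivative : deriv (Δ x₂ (Δ x₁ f)) m ys ≈ deriv f (suc (suc m)) (x₁ Vector.∷ x₂ Vector.∷ ys)
    second-derivative = sym (trans (deriv-suc f (suc m) _) (deriv-suc (Δ x₁ f) m _))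

  first-argument-additive : ∀ {f} → Congruent f → ∀ m →
    (∀ xs → deriv f (suc (suc m)) xs ≈ 0#) → ∀ ys → Additive (λ x → deriv (Δ x f) m ys)
  first-argument-additive fc m vanish ys x₁ x₂ =
    trans (deriv-first-+ fc m x₁ x₂ ys) (trans (+-congʳ (vanish _)) (+-identityˡ _))

  -- d°(f) ≤ k means every derivative of order > k vanishes identically; this
  -- needs decidability of ≈ to turn "not not zero" into "zero".
  deriv-above-degree : ∀ {f k m} → DegLe f k → k < m → ∀ xs → deriv f m xs ≈ 0#
  deriv-above-degree {f} {k} {m} deg k<m xs with deriv f m xs ≟ 0#
  ... | yes isZero  = isZero
  ... | no notZero = ⊥-elim (<⇒≱ k<m (deg m (λ allZero → notZero (allZero xs))))

  additive⇒linear : ∀ {g} → Additive g → Congruent g → IsFpLinear g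
  additive⇒linear {g} add gc = add , commutes
    where
    g0≈0 : g 0# ≈ 0#
    g0≈0 = x+x≈x⇒x≈0 _ (trans (sym (add 0# 0#)) (gc (+-identityˡ 0#)))
    commutes : ∀ k x → g (nmul k x) ≈ nmul k (g x)
    commutes zero    x = g0≈0
    commutes (suc k) x = trans (add _ _) (+-congˡ (commutes k x))

  linear-resp : ∀ {g h} → (∀ x → g x ≈ h x) → IsFpLinear h → IsFpLinear g
  linear-resp {g} {h} e (add , commutes) =
    (λ x y → trans (e _) (trans (add x y) (sym (+-cong (e x) (e y))))) ,
    (λ k x → trans (e _) (trans (commutes k x) (nmul-cong k (sym (e x)))))
    where
    nmul-cong : ∀ k {x y} → x ≈ y → nmul k x ≈ nmul k y
    nmul-cong zero    e = refl
    nmul-cong (suc k) e = +-cong e (nmul-cong k e)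

  pow-cong : ∀ d → Congruent (λ x → pow x d)
  pow-cong zero    e = refl
  pow-cong (suc d) e = *-cong e (pow-cong d e)

  pow-* : ∀ x y d → pow (x * y) d ≈ pow x d * pow y d
  pow-* x y zero    = sym (*-identityˡ 1#)
  pow-* x y (suc d) = begin
    (x * y) * pow (x * y) d        ≈⟨ *-congˡ (pow-* x y d) ⟩
    (x * y) * (pow x d * pow y d)  ≈⟨ *-assoc x y _ ⟩
    x * (y * (pow x d * pow y d))  ≈⟨ *-congˡ (*-swapˡ y _ _) ⟩
    x * (pow x d * (y * pow y d))  ≈⟨ *-assoc x _ _ ⟨
    (x * pow x d) * (y * pow y d)  ∎

  pow-1 : ∀ d → pow 1# d ≈ 1#
  pow-1 zero    = refl
  pow-1 (suc d) = trans (*-identityˡ _) (pow-1 d)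

  pow-inverse : ∀ d a → ¬ (a ≈ 0#) → pow a d * pow (a ⁻¹) d ≈ 1#
  pow-inverse d a a≉0 = trans (sym (pow-* a (a ⁻¹) d)) (trans (pow-cong d (⁻¹-inv a a≉0)) (pow-1 d))

  Btilde-homogeneous : ∀ d p t x y →
    Btilde (λ z → pow z d) p (t * x) (t * y) ≈ pow t d * Btilde (λ z → pow z d) p x y
  Btilde-homogeneous d p t x y =
    trans (deriv-cong-args (pow-cong d) p scaled) (deriv-scale (pow-cong d) p _ t _ (λ z → pow-* t z d))
    where
    scaled : ∀ i → xyy (t * x) (t * y) p i ≈ t * xyy x y p i
    scaled zero    = refl
    scaled (suc i) = refl

  Btilde-cong : ∀ {f} → Congruent f → ∀ p {x x′ y y′} → x ≈ x′ → y ≈ y′ →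
                Btilde f p x y ≈ Btilde f p x′ y′
  Btilde-cong fc p x≈x′ y≈y′ = deriv-cong-args fc p pointwise
    where
    pointwise : ∀ i → xyy _ _ p i ≈ xyy _ _ p i
    pointwise zero    = x≈x′
    pointwise (suc i) = y≈y′

  deriv-first-zero : ∀ {f} → Congruent f → ∀ m {a} → a ≈ 0# → ∀ ys → deriv (Δ a f) m ys ≈ 0#
  deriv-first-zero {f} fc m {a} a≈0 ys = begin
    deriv (Δ a f) m ys           ≈⟨ deriv-cong-fun m ys Δ≈0·f ⟩
    deriv (λ z → 0# * f z) m ys  ≈⟨ deriv-*-fun 0# f m ys ⟩
    0# * deriv f m ys            ≈⟨ zeroˡ _ ⟩
    0#                           ∎
    where
    Δ≈0·f : ∀ z → Δ a f z ≈ 0# * f z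
    Δ≈0·f z = trans (+-congʳ (fc (trans (+-congʳ a≈0) (+-identityˡ z))))
                    (trans (-‿inverseʳ (f z)) (sym (zeroˡ (f z))))

  ν-nonzero : ∀ {a} → ¬ (a ≈ 0#) → ν a ≡ a ⁻¹
  ν-nonzero {a} a≉0 with a ≟ 0#
  ... | yes a≈0 = ⊥-elim (a≉0 a≈0)
  ... | no _    = ≡.refl

  BtildeMuNu≈Btilde : ∀ q d x a →
    BtildeMuNu (suc q) d x a ≈ Btilde (λ z → pow z d) (suc q) (a * x) 1#
  BtildeMuNu≈Btilde q d x a with a ≟ 0#
  ... | yes a≈0 = sym (trans (deriv-suc (λ z → pow z d) q _)
                             (deriv-first-zero (pow-cong d) q (trans (*-congʳ a≈0) (zeroˡ x)) _))
  ... | no a≉0 = begin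
    pow a d * B x (ν a)                          ≡⟨ ≡.cong (λ b → pow a d * B x b) (ν-nonzero a≉0) ⟩
    pow a d * B x (a ⁻¹)                         ≈⟨ *-congˡ (Btilde-cong (pow-cong d) (suc q) x≈ a⁻¹≈) ⟩
    pow a d * B (a ⁻¹ * (a * x)) (a ⁻¹ * 1#)     ≈⟨ *-congˡ (Btilde-homogeneous d (suc q) (a ⁻¹) _ _) ⟩
    pow a d * (pow (a ⁻¹) d * B (a * x) 1#)      ≈⟨ *-assoc _ _ _ ⟨
    (pow a d * pow (a ⁻¹) d) * B (a * x) 1#      ≈⟨ *-congʳ (pow-inverse d a a≉0) ⟩
    1# * B (a * x) 1#                            ≈⟨ *-identityˡ _ ⟩
    B (a * x) 1#                                 ∎
    where
    B = Btilde (λ z → pow z d) (suc q)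
    x≈ : x ≈ a ⁻¹ * (a * x)
    x≈ = sym (trans (sym (*-assoc _ _ _))
                    (trans (*-congʳ (trans (*-comm _ _) (⁻¹-inv a a≉0))) (*-identityˡ x)))
    a⁻¹≈ : a ⁻¹ ≈ a ⁻¹ * 1#
    a⁻¹≈ = sym (*-identityʳ _)

  -- If d°(f) ≤ p then x ↦ B̃_f(x, y) is additive: peel off x and use that
  -- [f]^{p+1} vanishes identically.
  Btilde-additive : ∀ q {f} → Congruent f → DegLe f (suc q) → ∀ y → Additive (λ x → Btilde f (suc q) x y)
  Btilde-additive q {f} fc deg y x₁ x₂ = begin
    Btilde f (suc q) (x₁ + x₂) y                ≈⟨ peel (x₁ + x₂) ⟩
    deriv (Δ (x₁ + x₂) f) q (λ _ → y)
      ≈⟨ first-argument-additive fc q (deriv-above-degree {f = f} deg (n<1+n (suc q))) _ x₁ x₂ ⟩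
    deriv (Δ x₁ f) q (λ _ → y) + deriv (Δ x₂ f) q (λ _ → y) ≈⟨ +-cong (peel x₁) (peel x₂) ⟨
    Btilde f (suc q) x₁ y + Btilde f (suc q) x₂ y ∎
    where
    peel : ∀ x → Btilde f (suc q) x y ≈ deriv (Δ x f) q (λ _ → y)
    peel x = deriv-suc f q _

  scaled-bilinear : ∀ {L} → Additive L → Congruent L → IsFpBilinear (λ x a → L (a * x))
  scaled-bilinear {L} add Lc =
    (λ a → additive⇒linear (λ x y → trans (Lc (distribˡ a x y)) (add _ _)) (λ e → Lc (*-congˡ e))) ,
    (λ x → additive⇒linear (λ a b → trans (Lc (distribʳ x a b)) (add _ _)) (λ e → Lc (*-congʳ e)))

  bilinear-resp : ∀ {B B′ : Carrier → Carrier → Carrier} → (∀ x a → B x a ≈ B′ x a) →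
                  IsFpBilinear B′ → IsFpBilinear B
  bilinear-resp e (linear₁ , linear₂) =
    (λ a → linear-resp (λ x → e x a) (linear₁ a)) , (λ x → linear-resp (e x) (linear₂ x))

-- For p = q + 1: B̃_{f,μ,ν}(x,a) = B̃_f(ax, 1), and z ↦ B̃_f(z, 1) is additive
-- because d°(f) ≤ p.
proposition5p2 : ∀ {c ℓ} (F : Field c ℓ) (p n d : ℕ) → Prime p → 1 ≤ n → HasCard F (p ^ n)
    → FieldOps.DegLe F (λ x → FieldOps.pow F x d) p
    → FieldOps.IsFpBilinear F (FieldOps.BtildeMuNu F p d)
proposition5p2 F zero    n d p-prime _ _ _   = ⊥-elim (¬prime[0] p-prime)
proposition5p2 F (suc q) n d _       _ _ deg =
  bilinear-resp (BtildeMuNu≈Btilde q d)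
    (scaled-bilinear (Btilde-additive q (pow-cong d) deg 1#)
                     (λ z≈z′ → Btilde-cong (pow-cong d) (suc q) z≈z′ refl))
  where
  open Field F using (refl; 1#)
  open DiscreteDerivatives F
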